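{- Let $\Sigma_2$ be the signature with two sorts $\sigma_1,\sigma_2$ and no function or predicate symbols other than equality, and let ${\cal T}_{2,3}$ be the $\Sigma_2$-theory consisting of all $\Sigma_2$-structures ${\cal A}$ such that either ($|\sigma_1^{\cal A}|=2$ and $\sigma_2^{\cal A}$ is infinite) or ($|\sigma_1^{\cal A}|\ge 3$ and $|\sigma_2^{\cal A}|\ge 3$). Then ${\cal T}_{2,3}$ is not strongly finitely witnessable w.r.t. $\{\sigma_1,\sigma_2\}$.
   Context: Many-sorted first-order logic with equality. A ${\cal T}$-interpretation is an interpretation whose underlying structure is in ${\cal T}$; formulas are ${\cal T}$-equivalent if satisfied by the same ${\cal T}$-interpretations. $\mathit{vars}_\sigma(\phi)$ is the set of free variables of sort $\sigma$ in $\phi$, $\mathit{vars}(\phi)$ all free variables, $X^{\cal A}=\{x^{\cal A}:x\in X\}$; $QF(\Sigma)$ is the set of quantifier-free $\Sigma$-formulas. An arrangement of a finite set $V$ of variables is a conjunction, over each sort $\sigma$, of equalities $x=y$ for $(x,y)\in E_\sigma$ and disequalities $x\neq y$ for the other pairs of variables of $V$ of sort $\sigma$, where $E_\sigma$ is an equivalence relation on the variables of $V$ of sort $\sigma$. For a set $S$ of sorts, a ${\cal T}$-interpretation ${\cal A}$ finitely witnesses $\phi$ for ${\cal T}$ w.r.t. $S$ if ${\cal A}\models\phi$ and $\sigma^{\cal A}=\mathit{vars}_\sigma(\phi)^{\cal A}$ for all $\sigma\in S$; $\phi$ is finitely witnessed if it is ${\cal T}$-unsatisfiable or has such a finite witness;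 $\phi$ is strongly finitely witnessed if $\phi\wedge\delta_V$ is finitely witnessed for every arrangement $\delta_V$ of every finite set $V$ of variables with sorts in $S$. A strong witness for ${\cal T}$ w.r.t. $S$ is a function $\mathit{wit}:QF(\Sigma)\to QF(\Sigma)$ such that for every $\phi$: $\phi$ and $\exists\vec w.\mathit{wit}(\phi)$ are ${\cal T}$-equivalent, with $\vec w=\mathit{vars}(\mathit{wit}(\phi))\setminus\mathit{vars}(\phi)$, and $\mathit{wit}(\phi)$ is strongly finitely witnessed for ${\cal T}$ w.r.t. $S$. ${\cal T}$ is strongly finitely witnessable w.r.t. $S$ if it has a computable strong witness. -}

module Defs where

open import Data.Nat using (ℕ)
open import Data.Fin using (Fin)
open import Data.Bool using (Bool; true; false; if_then_else_)
open import Data.List using (List; []; _∷_; _++_; concatMap; foldr)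
open import Data.List.Membership.Propositional using (_∈_; _∉_)
open import Data.Product using (Σ; _×_; _,_)
open import Data.Sum using (_⊎_)
open import Data.Unit using (⊤)
open import Data.Empty using (⊥)
open import Relation.Nullary using (¬_)
open import Relation.Binary.PropositionalEquality using (_≡_)
open import Function.Bundles using (_↔_; _↣_)

data Sort : Set where
  σ₁ σ₂ : Sort

-- Variables: for each sort, countably many variables indexed by ℕ.
-- Quantifier-free Σ₂-formulas: the only atoms are equalities between
-- two variables of the same sort.
data QF : Set where
  tt ff : QF
  eq    : Sort → ℕ → ℕ → QF
  ¬'_   : QF → QF
  _∧'_  : QF → QF → QF
  _∨'_  : QF → QF → QF

Structure : Set₁
Structure = Sort → Set

Assignment : Structure → Set
Assignment A = (σ : Sort) → ℕ → A σ

⟦_⟧ : QF → (A : Structure) → Assignment A → Set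
⟦ tt ⟧      A ρ = ⊤
⟦ ff ⟧      A ρ = ⊥
⟦ eq σ x y ⟧ A ρ = ρ σ x ≡ ρ σ y
⟦ ¬' φ ⟧    A ρ = ¬ ⟦ φ ⟧ A ρ
⟦ φ ∧' ψ ⟧  A ρ = ⟦ φ ⟧ A ρ × ⟦ ψ ⟧ A ρ
⟦ φ ∨' ψ ⟧  A ρ = ⟦ φ ⟧ A ρ ⊎ ⟦ ψ ⟧ A ρ

sameSort : Sort → Sort → Bool
sameSort σ₁ σ₁ = true
sameSort σ₂ σ₂ = true
sameSort _  _  = false

vars : Sort → QF → List ℕ
vars σ tt = []
vars σ ff = []
vars σ (eq τ x y) = if sameSort σ τ then x ∷ y ∷ [] else []
vars σ (¬' φ) = vars σ φ
vars σ (φ ∧' ψ) = vars σ φ ++ vars σ ψ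
vars σ (φ ∨' ψ) = vars σ φ ++ vars σ ψ

Theory : Set₁
Theory = Structure → Set

SortSet : Set₁
SortSet = Sort → Set

FinWitness : Theory → SortSet → QF → (A : Structure) → Assignment A → Set
FinWitness T S φ A ρ =
  T A × ⟦ φ ⟧ A ρ ×
  ((σ : Sort) → S σ → (a : A σ) → Σ ℕ λ x → x ∈ vars σ φ × ρ σ x ≡ a)

Unsat : Theory → QF → Set₁
Unsat T φ = (A : Structure) → T A → (ρ : Assignment A) → ¬ ⟦ φ ⟧ A ρ

FinitelyWitnessed : Theory → SortSet → QF → Set₁
FinitelyWitnessed T S φ =
  Unsat T φ ⊎ Σ Structure λ A → Σ (Assignment A) λ ρ → FinWitness T S φ A ρ

record Arrangement (S : SortSet) : Set where
  field
    V     : Sort → List ℕ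
    V-S   : (σ : Sort) (x : ℕ) → x ∈ V σ → S σ
    E     : Sort → ℕ → ℕ → Bool
    E-refl  : (σ : Sort) (x : ℕ) → x ∈ V σ → E σ x x ≡ true
    E-sym   : (σ : Sort) (x y : ℕ) → x ∈ V σ → y ∈ V σ →
              E σ x y ≡ true → E σ y x ≡ true
    E-trans : (σ : Sort) (x y z : ℕ) → x ∈ V σ → y ∈ V σ → z ∈ V σ →
              E σ x y ≡ true → E σ y z ≡ true → E σ x z ≡ true

⋀ : List QF → QF
⋀ = foldr _∧'_ tt

δ : {S : SortSet} → Arrangement S → QF
δ arr = ⋀ (concatMap (λ σ → concatMap (λ x → concatMap (λ y →
           (if E σ x y then eq σ x y else ¬' eq σ x y) ∷ []) (V σ)) (V σ))
         (σ₁ ∷ σ₂ ∷ []))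
  where open Arrangement arr

StronglyFinitelyWitnessed : Theory → SortSet → QF → Set₁
StronglyFinitelyWitnessed T S φ =
  (arr : Arrangement S) → FinitelyWitnessed T S (φ ∧' δ arr)

-- Satisfaction of ∃ w⃗. ψ where w⃗ = vars(ψ) ∖ vars(φ).
ExistsFresh : QF → QF → (A : Structure) → Assignment A → Set
ExistsFresh φ ψ A ρ =
  Σ (Assignment A) λ ρ' →
    ((σ : Sort) (x : ℕ) → ¬ (x ∈ vars σ ψ × x ∉ vars σ φ) → ρ' σ x ≡ ρ σ x)
    × ⟦ ψ ⟧ A ρ'

StrongWitness : Theory → SortSet → (QF → QF) → Set₁
StrongWitness T S wit =
  (φ : QF) →
    ((A : Structure) → T A → (ρ : Assignment A) →
       (⟦ φ ⟧ A ρ → ExistsFresh φ (wit φ) A ρ) ×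
       (ExistsFresh φ (wit φ) A ρ → ⟦ φ ⟧ A ρ))
    × StronglyFinitelyWitnessed T S (wit φ)

-- T is strongly finitely witnessable w.r.t. S: it has a computable strong
-- witness (every Agda function is computable).
StronglyFinitelyWitnessable : Theory → SortSet → Set₁
StronglyFinitelyWitnessable T S = Σ (QF → QF) λ wit → StrongWitness T S wit

Finite : Set → Set
Finite B = Σ ℕ λ n → B ↔ Fin n

Infinite : Set → Set
Infinite B = ¬ Finite B

T₂₃ : Theory
T₂₃ A = ((Fin 2 ↔ A σ₁) × Infinite (A σ₂))
      ⊎ ((Fin 3 ↣ A σ₁) × (Fin 3 ↣ A σ₂))

allSorts : SortSet
allSorts _ = ⊤

-- Take φ = ⊤ and the model M with σ₁ of size 2 and σ₂ = ℕ. Some assignment ρ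
-- satisfies ψ = wit(⊤) in M; let δ be the arrangement that ρ induces on the
-- variables of ψ. Then ψ ∧ δ is satisfiable, so it has a finite witness B.
-- Every element of B is named by a variable of ψ, and δ makes B identify two
-- such variables exactly when ρ does; hence each sort of B embeds into the
-- corresponding sort of M. So σ₁ has at most two elements in B and σ₂ is
-- finite in B, and neither disjunct of T₂₃ can hold.
module Submission where

open import Defs
open import Relation.Nullary using (¬_; Dec; yes; no; does)

open import Data.Bool using (true; false; if_then_else_)
open import Data.Empty using (⊥-elim)
open import Data.Fin using (Fin; zero; suc)
open import Data.Fin.Properties
  using (ℕ→Fin-notInjective; <⇒notInjective) renaming (_≟_ to _≟ᶠ_)
open import Data.List using (List; []; _∷_; map; concatMap; length; lookup; deduplicate)
open import Data.List.Membership.Propositional using (_∈_; find)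
open import Data.List.Membership.Propositional.Properties
  using (∈-lookup; ∈-deduplicate⁺; ∈-++⁻; ∈-map⁺)
open import Data.List.Membership.Propositional.Properties.WithK using (unique⇒irrelevant)
open import Data.List.Relation.Unary.All as All using (All; []; _∷_)
import Data.List.Relation.Unary.All.Properties as All
open import Data.List.Relation.Unary.Any using (Any; here; there; index)
open import Data.List.Relation.Unary.Any.Properties using (lookup-index; concatMap⁻)
open import Data.List.Relation.Unary.Unique.DecPropositional.Properties using (deduplicate-!)
open import Data.Nat using (ℕ)
open import Data.Nat.Properties using (n<1+n) renaming (_≟_ to _≟ⁿ_)
open import Data.Product using (Σ; _×_; _,_; proj₁; proj₂)
open import Data.Sum using (_⊎_; inj₁; inj₂; [_,_]′)
open import Data.Unit using (tt)
open import Function using (_∘_; const; id)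
open import Function.Bundles
  using (_↣_; _⇔_; Inverse; Injection; Equivalence; mk↔ₛ′; mk↣; mk⇔)
open import Function.Construct.Composition using (_↣-∘_)
open import Function.Construct.Identity using (↔-id)
open import Function.Properties.Inverse using (↔⇒↣)
open import Relation.Binary.Definitions using (DecidableEquality)
open import Relation.Binary.PropositionalEquality using (_≡_; refl; sym; trans; cong)
open Relation.Binary.PropositionalEquality.≡-Reasoning
open import Relation.Nullary.Decidable using (dec-true; via-injection)

index-∈-lookup : {B : Set} (xs : List B) (i : Fin (length xs)) →
                 index (∈-lookup {xs = xs} i) ≡ i
index-∈-lookup (x ∷ xs) zero    = refl
index-∈-lookup (x ∷ xs) (suc i) = cong suc (index-∈-lookup xs i)

enumerable⇒finite : {B : Set} → DecidableEquality B →
                    (xs : List B) → (∀ b → b ∈ xs) → Finite B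
enumerable⇒finite {B} _≟_ xs _∈xs =
  length ys , mk↔ₛ′ position (lookup ys) position∘lookup lookup∘position
  where
  ys : List B
  ys = deduplicate _≟_ xs

  _∈ys : ∀ b → b ∈ ys
  b ∈ys = ∈-deduplicate⁺ _≟_ (b ∈xs)

  position : B → Fin (length ys)
  position b = index (b ∈ys)

  position∘lookup : ∀ i → position (lookup ys i) ≡ i
  position∘lookup i = trans (cong index (unique⇒irrelevant (deduplicate-! _≟_ xs) _ _))
                            (index-∈-lookup ys i)

  lookup∘position : ∀ b → lookup ys (position b) ≡ b
  lookup∘position b = sym (lookup-index (b ∈ys))

ℕ-infinite : Infinite ℕ
ℕ-infinite (_ , ℕ↔Fin) =
  ℕ→Fin-notInjective (Inverse.to ℕ↔Fin) (Injection.injective (↔⇒↣ ℕ↔Fin))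

from-does : {P : Set} (p? : Dec P) → does p? ≡ true → P
from-does (yes p) _ = p

module _ {B : Structure} {μ : Assignment B} where

  ⋀⁺ : {l : List QF} → All (λ φ → ⟦ φ ⟧ B μ) l → ⟦ ⋀ l ⟧ B μ
  ⋀⁺ []       = tt
  ⋀⁺ (p ∷ ps) = p , ⋀⁺ ps

  ⋀⁻ : (l : List QF) → ⟦ ⋀ l ⟧ B μ → All (λ φ → ⟦ φ ⟧ B μ) l
  ⋀⁻ []      _        = []
  ⋀⁻ (φ ∷ l) (p , ps) = p ∷ ⋀⁻ l ps

vars-⋀ : ∀ {σ z} (l : List QF) → z ∈ vars σ (⋀ l) → Any (λ φ → z ∈ vars σ φ) l
vars-⋀ {σ} (φ ∷ l) z∈ = [ here , there ∘ vars-⋀ l ]′ (∈-++⁻ (vars σ φ) z∈)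

vars-eq : ∀ {σ τ x y z} → z ∈ vars σ (eq τ x y) → σ ≡ τ × (z ≡ x ⊎ z ≡ y)
vars-eq {σ₁} {σ₁} (here z≡x)         = refl , inj₁ z≡x
vars-eq {σ₁} {σ₁} (there (here z≡y)) = refl , inj₂ z≡y
vars-eq {σ₂} {σ₂} (here z≡x)         = refl , inj₁ z≡x
vars-eq {σ₂} {σ₂} (there (here z≡y)) = refl , inj₂ z≡y

All-concatMap⁺ : {A C : Set} {P : C → Set} (f : A → List C) {xs : List A} →
                 All (λ x → All P (f x)) xs → All P (concatMap f xs)
All-concatMap⁺ _ = All.concat⁺ ∘ All.map⁺

All-concatMap-lookup : {A C : Set} {P : C → Set} (f : A → List C) {xs : List A} {x : A} →
                       All P (concatMap f xs) → x ∈ xs → All P (f x)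
All-concatMap-lookup _ h = All.lookup (All.map⁻ (All.concat⁻ h))

sorts : List Sort
sorts = σ₁ ∷ σ₂ ∷ []

sort∈ : (σ : Sort) → σ ∈ sorts
sort∈ σ₁ = here refl
sort∈ σ₂ = there (here refl)

module _ {S : SortSet} (arr : Arrangement S) where
  open Arrangement arr

  -- clause, clausesAt and clausesOf spell out the body of δ, so that
  -- δ arr is definitionally ⋀ (concatMap clausesOf sorts).
  clause : Sort → ℕ → ℕ → QF
  clause σ x y = if E σ x y then eq σ x y else ¬' eq σ x y

  clausesAt : Sort → ℕ → List QF
  clausesAt σ x = concatMap (λ y → clause σ x y ∷ []) (V σ)

  clausesOf : Sort → List QF
  clausesOf σ = concatMap (clausesAt σ) (V σ)

  module _ {B : Structure} {μ : Assignment B} where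

    δ-intro : (∀ σ {x y} → x ∈ V σ → y ∈ V σ → ⟦ clause σ x y ⟧ B μ) → ⟦ δ arr ⟧ B μ
    δ-intro h = ⋀⁺ (All-concatMap⁺ clausesOf (clauses σ₁ ∷ clauses σ₂ ∷ []))
      where
      clauses : ∀ σ → All (λ φ → ⟦ φ ⟧ B μ) (clausesOf σ)
      clauses σ = All-concatMap⁺ (clausesAt σ) (All.tabulate λ {x} x∈ →
                    All-concatMap⁺ (λ y → clause σ x y ∷ [])
                      (All.tabulate λ y∈ → h σ x∈ y∈ ∷ []))

    δ-elim : ⟦ δ arr ⟧ B μ → ∀ σ {x y} → x ∈ V σ → y ∈ V σ → ⟦ clause σ x y ⟧ B μ
    δ-elim h σ {x} {y} x∈ y∈ =
      All.head (All-concatMap-lookup (λ y → clause σ x y ∷ [])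
                 (All-concatMap-lookup (clausesAt σ)
                   (All-concatMap-lookup clausesOf (⋀⁻ _ h) (sort∈ σ)) x∈) y∈)

  vars-clause : ∀ {σ τ x y z} → z ∈ vars σ (clause τ x y) → σ ≡ τ × (z ≡ x ⊎ z ≡ y)
  vars-clause {τ = τ} {x} {y} with E τ x y
  ... | true  = vars-eq
  ... | false = vars-eq

  vars-δ : ∀ {σ z} → z ∈ vars σ (δ arr) → z ∈ V σ
  vars-δ z∈
    with find (concatMap⁻ clausesOf {xs = sorts} (vars-⋀ (concatMap clausesOf sorts) z∈))
  ... | τ , _ , z∈τ with find (concatMap⁻ (clausesAt τ) {xs = V τ} z∈τ)
  ... | x , x∈ , z∈x with find (concatMap⁻ (λ y → clause τ x y ∷ []) {xs = V τ} z∈x)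
  ... | y , y∈ , here z∈xy with vars-clause z∈xy
  ... | refl , inj₁ refl = x∈
  ... | refl , inj₂ refl = y∈

module Induced {A : Structure} (decEq : ∀ σ → DecidableEquality (A σ))
               (ρ : Assignment A) (φ : QF) where

  induced : Arrangement allSorts
  induced = record
    { V       = λ σ → vars σ φ
    ; V-S     = λ _ _ _ → tt
    ; E       = λ σ x y → does (decEq σ (ρ σ x) (ρ σ y))
    ; E-refl  = λ σ x _ → dec-true (decEq σ _ _) refl
    ; E-sym   = λ σ x y _ _ xy → dec-true (decEq σ _ _) (sym (from-does (decEq σ _ _) xy))
    ; E-trans = λ σ x y z _ _ _ xy yz →
        dec-true (decEq σ _ _)
                 (trans (from-does (decEq σ _ _) xy) (from-does (decEq σ _ _) yz))
    }

  ρ⊨clause : ∀ σ x y → ⟦ clause induced σ x y ⟧ A ρ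
  ρ⊨clause σ x y with decEq σ (ρ σ x) (ρ σ y)
  ... | yes ρx≡ρy = ρx≡ρy
  ... | no  ρx≢ρy = ρx≢ρy

  ρ⊨δ : ⟦ δ induced ⟧ A ρ
  ρ⊨δ = δ-intro induced λ σ {x} {y} _ _ → ρ⊨clause σ x y

  clause⇒same-equalities : ∀ {B : Structure} {μ : Assignment B} σ x y →
    ⟦ clause induced σ x y ⟧ B μ → (μ σ x ≡ μ σ y ⇔ ρ σ x ≡ ρ σ y)
  clause⇒same-equalities σ x y with decEq σ (ρ σ x) (ρ σ y)
  ... | yes ρx≡ρy = λ μx≡μy → mk⇔ (const ρx≡ρy) (const μx≡μy)
  ... | no  ρx≢ρy = λ μx≢μy → mk⇔ (⊥-elim ∘ μx≢μy) (⊥-elim ∘ ρx≢ρy)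

  module _ {B : Structure} {μ : Assignment B} (μ⊨δ : ⟦ δ induced ⟧ B μ)
           (covered : ∀ σ (b : B σ) → Σ ℕ λ x → x ∈ vars σ (φ ∧' δ induced) × μ σ x ≡ b) where

    named : ∀ σ (b : B σ) → Σ ℕ λ x → x ∈ vars σ φ × μ σ x ≡ b
    named σ b with covered σ b
    ... | x , x∈ , μx≡b = x , [ id , vars-δ induced ]′ (∈-++⁻ (vars σ φ) x∈) , μx≡b

    witness-enumerated : ∀ σ (b : B σ) → b ∈ map (μ σ) (vars σ φ)
    witness-enumerated σ b with named σ b
    ... | x , x∈ , refl = ∈-map⁺ (μ σ) x∈

    witness↣ : ∀ σ → B σ ↣ A σ
    witness↣ σ = mk↣ {to = ρ σ ∘ name} injective
      where
      name : B σ → ℕ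
      name b = proj₁ (named σ b)

      μ∘name : ∀ b → μ σ (name b) ≡ b
      μ∘name b = proj₂ (proj₂ (named σ b))

      injective : ∀ {b b′} → ρ σ (name b) ≡ ρ σ (name b′) → b ≡ b′
      injective {b} {b′} ρ-equal = begin
        b              ≡⟨ sym (μ∘name b) ⟩
        μ σ (name b)   ≡⟨ Equivalence.from (clause⇒same-equalities σ _ _ μ⊨clause) ρ-equal ⟩
        μ σ (name b′)  ≡⟨ μ∘name b′ ⟩
        b′             ∎
        where
        μ⊨clause : ⟦ clause induced σ (name b) (name b′) ⟧ B μ
        μ⊨clause = δ-elim induced μ⊨δ σ
                     (proj₁ (proj₂ (named σ b))) (proj₁ (proj₂ (named σ b′)))

¬T₂₃ : {B : Structure} → B σ₁ ↣ Fin 2 → Finite (B σ₂) → ¬ T₂₃ B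
¬T₂₃ _      B₂-finite (inj₁ (_ , B₂-infinite)) = B₂-infinite B₂-finite
¬T₂₃ B₁↣Fin2 _        (inj₂ (Fin3↣B₁ , _))     =
  <⇒notInjective (n<1+n 2) (Injection.injective (B₁↣Fin2 ↣-∘ Fin3↣B₁))

M : Structure
M σ₁ = Fin 2
M σ₂ = ℕ

M∈T₂₃ : T₂₃ M
M∈T₂₃ = inj₁ (↔-id (Fin 2) , ℕ-infinite)

M-decEq : ∀ σ → DecidableEquality (M σ)
M-decEq σ₁ = _≟ᶠ_
M-decEq σ₂ = _≟ⁿ_

origin : Assignment M
origin σ₁ _ = zero
origin σ₂ _ = 0

lemma3 : ¬ StronglyFinitelyWitnessable T₂₃ allSorts
lemma3 (wit , strong) with strong tt
... | equivalent , strongly-witnessed with proj₁ (equivalent M M∈T₂₃ origin) tt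
... | ρ , _ , ρ⊨ψ = [ satisfiable , no-finite-witness ]′ (strongly-witnessed induced)
  where
  open Induced M-decEq ρ (wit tt)

  satisfiable : ¬ Unsat T₂₃ (wit tt ∧' δ induced)
  satisfiable unsat = unsat M M∈T₂₃ ρ (ρ⊨ψ , ρ⊨δ)

  no-finite-witness : ¬ (Σ Structure λ B → Σ (Assignment B) λ μ →
                           FinWitness T₂₃ allSorts (wit tt ∧' δ induced) B μ)
  no-finite-witness (B , μ , B∈T₂₃ , (_ , μ⊨δ) , covering) =
    ¬T₂₃ {B} (witness↣ μ⊨δ covered σ₁)
         (enumerable⇒finite (via-injection (witness↣ μ⊨δ covered σ₂) _≟ⁿ_) _
                            (witness-enumerated μ⊨δ covered σ₂))
         B∈T₂₃
    where
    covered : ∀ σ (b : B σ) → Σ ℕ λ x → x ∈ vars σ (wit tt ∧' δ induced) × μ σ x ≡ b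
    covered σ = covering σ tt
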